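{- Let $\Gamma$ be an $\omega$-clique regular graph ($\omega\ge2$) with vertex set $V$ and edge set $E$, and let $S=S_\omega(\Gamma)$ with edge set $E_S$. Define the $\mathbb{Z}$-linear maps $h:\mathbb{Z}^{E_S}\to\mathbb{Z}^E$ by $h(v,C)=\sum_{u\in C\setminus\{v\}}(v,u)$ and $h^\top:\mathbb{Z}^E\to\mathbb{Z}^{E_S}$ by $h^\top(x,y)=(x,C_{xy})+(C_{xy},y)$, where $C_{xy}$ is the unique clique of order $\omega$ containing the edge $\{x,y\}$. Then for every $a\in\mathbb{Z}^E$ one has $h(h^\top(a))-\omega a\in B\oplus Z$, and for every $b\in\mathbb{Z}^{E_S}$ one has $h^\top(h(b))-\omega b\in B_S\oplus Z_S$; that is, the maps induced by $h h^\top$ on $\mathbb{Z}^E/(B\oplus Z)\cong\mathcal{K}(\Gamma)$ and by $h^\top h$ on $\mathbb{Z}^{E_S}/(B_S\oplus Z_S)\cong\mathcal{K}(S)$ are multiplication by $\omega$.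
   Context: All graphs are finite, without loops or parallel edges. A graph is $\omega$-clique regular if its edge set is nonempty and every edge lies in exactly one clique of order $\omega$. $S_\omega(\Gamma)$ is the bipartite graph on the disjoint union of the vertices of $\Gamma$ and the cliques of order $\omega$ of $\Gamma$, with $v$ adjacent to $C$ iff $v\in C$. For a graph $H=(V_H,E_H)$ fix an orientation of each edge; $\mathbb{Z}^{E_H}$ is the free abelian group on the oriented edges $(x,y)$, with the convention $(y,x)=-(x,y)$. The bond of a vertex $v$ is $b(v)=\sum_{u\in N(v)}(v,u)$; the bond space is the $\mathbb{Z}$-span of all bonds; the cycle space is the $\mathbb{Z}$-span of all directed cycles $\sum_{j=1}^{\ell}(u_{j-1},u_j)$ (with $u_{j-1}$ adjacent to $u_j$, $u_0=u_\ell$, other vertices distinct). $B,Z$ denote the bond and cycle spaces of $\Gamma$, and $B_S,Z_S$ those of $S_\omega(\Gamma)$. The critical group $\mathcal{K}(H)$ is the torsion part of the cokernel of the Laplacian $D-A$ of $H$ on $\mathbb{Z}^{V_H}$, and it is isomorphic to $\mathbb{Z}^{E_H}$ modulo the sum of the bond and cycle spaces. -}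

module Defs where

open import Data.Nat as ℕ using (ℕ; zero; suc; _≡ᵇ_; _<ᵇ_)
open import Data.Integer as ℤ using (ℤ; +_; 0ℤ; 1ℤ; _+_; _-_; _*_; -_)
open import Data.Bool using (Bool; true; false; T; if_then_else_; _∧_; _∨_; not)
open import Data.Bool.Properties using (T-irrelevant; T?)
import Data.Bool.Properties as BoolP
open import Data.Fin as Fin using (Fin; toℕ)
open import Data.Fin.Subset using (Subset; ∣_∣; _∈_)
open import Data.Vec using (Vec; []; _∷_; lookup)
import Data.Vec.Properties as VecP
open import Data.List using (List; []; _∷_; _++_; map; foldr; allFin; mapMaybe)
open import Data.List.Relation.Unary.All using (All)
open import Data.List.Relation.Unary.Unique.Propositional using (Unique)
open import Data.Maybe using (Maybe; just; nothing)
open import Data.Product using (Σ; ∃; ∃!; _×_; _,_; proj₁; proj₂)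
open import Data.Sum using (_⊎_; inj₁; inj₂)
import Data.Sum.Properties as SumP
open import Relation.Nullary using (Dec; yes; no; ¬_; does)
open import Relation.Binary.Definitions using (DecidableEquality)
open import Relation.Binary.PropositionalEquality using (_≡_; refl; cong)

record Graph : Set₁ where
  field
    V       : Set
    _≟_     : DecidableEquality V
    adj     : V → V → Bool
    adj-sym : ∀ x y → adj x y ≡ adj y x
    adj-irr : ∀ x → adj x x ≡ false

module _ (G : Graph) where
  open Graph G

  -- An element of Z^{E_G}: an integer function on ordered pairs of
  -- vertices; genuine elements of Z^{E_G} are the ones satisfying
  -- IsChain, i.e. (y,x) = -(x,y) and support contained in the edges.
  EVec : Set
  EVec = V → V → ℤ

  IsChain : EVec → Set
  IsChain f = (∀ x y → f x y ≡ - f y x)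
            × (∀ x y → adj x y ≡ false → f x y ≡ 0ℤ)

  δ : V → V → ℤ
  δ x y = if does (x ≟ y) then 1ℤ else 0ℤ

  oedge : V → V → EVec
  oedge x y p q = δ p x * δ q y - δ p y * δ q x

  zeroV : EVec
  zeroV _ _ = 0ℤ

  _⊕_ : EVec → EVec → EVec
  (f ⊕ g) p q = f p q + g p q

  _⊖_ : EVec → EVec → EVec
  (f ⊖ g) p q = f p q - g p q

  _·_ : ℤ → EVec → EVec
  (k · f) p q = k * f p q

  vsum : List EVec → EVec
  vsum = foldr _⊕_ zeroV

  -- bond b(v) = Σ_{u ∈ N(v)} (v,u), written out coordinatewise:
  -- its value at (p,q) is [p ~ q]([p = v] - [q = v]).
  bond : V → EVec
  bond v p q = if adj p q then δ p v - δ q v else 0ℤ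

  cycPairs : V → List V → List (V × V)
  cycPairs u0 []       = []
  cycPairs u0 (u ∷ us) = go u us
    where
    go : V → List V → List (V × V)
    go a []       = (a , u0) ∷ []
    go a (b ∷ bs) = (a , b) ∷ go b bs

  pairsOf : V → List V → List (V × V)
  pairsOf u0 []       = (u0 , u0) ∷ []
  pairsOf u0 (u ∷ us) = (u0 , u) ∷ cycPairs u0 (u ∷ us)

  record Cycle : Set where
    constructor mkCycle
    field
      u0       : V
      rest     : List V
      distinct : Unique (u0 ∷ rest)
      adjacent : All (λ pq → T (adj (proj₁ pq) (proj₂ pq))) (pairsOf u0 rest)

  cycleVec : Cycle → EVec
  cycleVec c = vsum (map (λ pq → oedge (proj₁ pq) (proj₂ pq))
                         (pairsOf (Cycle.u0 c) (Cycle.rest c)))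

  InBondPlusCycle : EVec → Set
  InBondPlusCycle f =
    Σ (List (ℤ × V)) λ bs → Σ (List (ℤ × Cycle)) λ cs →
      ∀ p q → f p q ≡ vsum (map (λ kv → proj₁ kv · bond (proj₂ kv)) bs
                            ++ map (λ kc → proj₁ kc · cycleVec (proj₂ kc)) cs) p q

allB : {A : Set} → (A → Bool) → List A → Bool
allB p = foldr (λ x b → p x ∧ b) true

allSubsets : (n : ℕ) → List (Subset n)
allSubsets zero    = [] ∷ []
allSubsets (suc n) = map (false ∷_) (allSubsets n) ++ map (true ∷_) (allSubsets n)

module Setup (n : ℕ) (adj : Fin n → Fin n → Bool)
             (adj-sym : ∀ x y → adj x y ≡ adj y x)
             (adj-irr : ∀ x → adj x x ≡ false)
             (ω : ℕ) where

  Γ : Graph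
  Γ = record { V = Fin n ; _≟_ = Fin._≟_ ; adj = adj
             ; adj-sym = adj-sym ; adj-irr = adj-irr }

  isωClique : Subset n → Bool
  isωClique C = (∣ C ∣ ≡ᵇ ω) ∧
    allB (λ x → allB (λ y → not (lookup C x ∧ lookup C y ∧ not (does (x Fin.≟ y)))
                          ∨ adj x y) (allFin n)) (allFin n)

  Clique : Set
  Clique = Σ (Subset n) (λ C → T (isωClique C))

  Clique-≟ : DecidableEquality Clique
  Clique-≟ (C , p) (D , q) with VecP.≡-dec BoolP._≟_ C D
  ... | yes refl = yes (cong (C ,_) (T-irrelevant p q))
  ... | no  C≢D  = no λ { refl → C≢D refl }

  toClique : Subset n → Maybe Clique
  toClique C with T? (isωClique C)
  ... | yes p = just (C , p)
  ... | no  _ = nothing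

  cliques : List Clique
  cliques = mapMaybe toClique (allSubsets n)

  CliqueRegular : Set
  CliqueRegular =
    (∃ λ x → ∃ λ y → T (adj x y)) ×
    (∀ x y → T (adj x y) →
       ∃! _≡_ (λ (C : Clique) → x ∈ proj₁ C × y ∈ proj₁ C))

  SV : Set
  SV = Fin n ⊎ Clique

  adjS : SV → SV → Bool
  adjS (inj₁ v) (inj₂ C) = lookup (proj₁ C) v
  adjS (inj₂ C) (inj₁ v) = lookup (proj₁ C) v
  adjS (inj₁ _) (inj₁ _) = false
  adjS (inj₂ _) (inj₂ _) = false

  adjS-sym : ∀ x y → adjS x y ≡ adjS y x
  adjS-sym (inj₁ v) (inj₂ C) = refl
  adjS-sym (inj₂ C) (inj₁ v) = refl
  adjS-sym (inj₁ _) (inj₁ _) = refl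
  adjS-sym (inj₂ _) (inj₂ _) = refl

  adjS-irr : ∀ x → adjS x x ≡ false
  adjS-irr (inj₁ _) = refl
  adjS-irr (inj₂ _) = refl

  S : Graph
  S = record { V = SV ; _≟_ = SumP.≡-dec Fin._≟_ Clique-≟ ; adj = adjS
             ; adj-sym = adjS-sym ; adj-irr = adjS-irr }

  hBasis : Fin n → Clique → EVec Γ
  hBasis v C = vsum Γ (map (λ u → if lookup (proj₁ C) u ∧ not (does (u Fin.≟ v))
                                   then oedge Γ v u else zeroV Γ) (allFin n))

  -- h extended Z-linearly; the edges of S are oriented as (v,C), v ∈ C,
  -- so b = Σ_{(v,C)} b(v,C)·(v,C).
  h : EVec S → EVec Γ
  h b = vsum Γ (map (λ v → vsum Γ (map (λ C →
          if lookup (proj₁ C) v then _·_ Γ (b (inj₁ v) (inj₂ C)) (hBasis v C)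
          else zeroV Γ) cliques)) (allFin n))

  module _ (reg : CliqueRegular) where

    Cxy : ∀ x y → T (adj x y) → Clique
    Cxy x y e = proj₁ (proj₂ reg x y e)

    hᵀBasis : ∀ x y → T (adj x y) → EVec S
    hᵀBasis x y e = _⊕_ S (oedge S (inj₁ x) (inj₂ (Cxy x y e)))
                          (oedge S (inj₂ (Cxy x y e)) (inj₁ y))

    -- the term a(x,y)·hᵀ(x,y) for the edge {x,y} oriented as (x,y), x < y
    hᵀTerm : EVec Γ → Fin n → Fin n → EVec S
    hᵀTerm a x y with toℕ x <ᵇ toℕ y | T? (adj x y)
    ... | true  | yes e = _·_ S (a x y) (hᵀBasis x y e)
    ... | _     | _     = zeroV S

    hᵀ : EVec Γ → EVec S
    hᵀ a = vsum S (map (λ x → vsum S (map (λ y → hᵀTerm a x y) (allFin n))) (allFin n))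

module Submission where

-- Both composites are ℤ-linear and every chain is a ℤ-combination of oriented edges,
-- so it suffices to evaluate them on edges.  For an edge (x,y) of Γ lying in the
-- ω-clique C, h hᵀ (x,y) = Σ_{u ∈ C∖x} (x,u) − Σ_{u ∈ C∖y} (y,u), which is ω (x,y)
-- plus the directed triangles x → u → y → x over u ∈ C∖{x,y}.  For an edge (v,C) of S,
-- hᵀ h (v,C) = Σ_{u ∈ C∖v} ((v,C) + (C,u)) = ω (v,C) + b(C), because (v,C) + (C,v) = 0.

open import Defs
import Data.Integer.Properties as ℤP
open import Algebra.Properties.CommutativeSemigroup ℤP.+-commutativeSemigroup
  using (interchange)
open import Data.Bool using (Bool; true; false; T; if_then_else_; _∧_; _∨_; not)
open import Data.Bool.Properties using (T-irrelevant; T?; T-∧)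
open import Data.Empty using (⊥-elim)
open import Data.Fin as Fin using (Fin; toℕ)
open import Data.Fin.Properties using (suc-injective; toℕ-injective)
open import Data.Fin.Subset using (Subset; ∣_∣)
open import Data.Integer using (ℤ; +_; 0ℤ; 1ℤ; -1ℤ; _+_; _-_; _*_; -_)
open import Data.Integer.Tactic.RingSolver using (solve-∀)
open import Data.List using (List; []; _∷_; _++_; map; allFin; mapMaybe)
open import Data.List.Membership.Propositional using (_∈_)
open import Data.List.Membership.Propositional.Properties using (∈-allFin)
open import Data.List.Properties using (map-tabulate)
open import Data.List.Relation.Unary.All using (All; []; _∷_)
open import Data.List.Relation.Unary.AllPairs using ([]; _∷_)
open import Data.List.Relation.Unary.Any using (here; there)
open import Data.List.Relation.Unary.Unique.Propositional using (Unique)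
open import Data.Maybe using (Maybe; just; nothing; maybe′)
open import Data.Nat using (ℕ; zero; suc; _≤_; _<ᵇ_; _≡ᵇ_)
import Data.Nat.Properties as ℕP
open import Data.Product using (_×_; _,_; proj₁; proj₂)
open import Data.Sum using (_⊎_; inj₁; inj₂)
open import Data.Sum.Properties using (inj₂-injective)
open import Data.Vec using (lookup; []; _∷_; tail)
open import Data.Vec.Properties using ([]=⇒lookup; lookup⇒[]=)
open import Function using (_∘_; id)
open import Function.Bundles using (Equivalence)
open import Level using (0ℓ)
open import Relation.Binary.Bundles using (Preorder)
open import Relation.Binary.Definitions using (tri<; tri≈; tri>)
open import Relation.Binary.PropositionalEquality
  using (_≡_; _≢_; refl; sym; trans; cong; cong₂; subst; module ≡-Reasoning)
import Relation.Binary.Reasoning.Preorder as PreorderReasoning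
open import Relation.Binary.Structures using (IsEquivalence)
open import Relation.Nullary using (¬_; yes; no; does; contradiction)

χ : Bool → ℤ
χ b = if b then 1ℤ else 0ℤ

∑ : {A : Set} → List A → (A → ℤ) → ℤ
∑ []       f = 0ℤ
∑ (x ∷ xs) f = f x + ∑ xs f

syntax ∑ l (λ x → e) = ∑[ x ∈ l ] e

module _ {A : Set} where

  ∑-cong : ∀ (l : List A) {f g : A → ℤ} → (∀ x → f x ≡ g x) → ∑ l f ≡ ∑ l g
  ∑-cong []      f≡g = refl
  ∑-cong (x ∷ l) f≡g = cong₂ _+_ (f≡g x) (∑-cong l f≡g)

  ∑-zero : ∀ (l : List A) {f : A → ℤ} → (∀ x → f x ≡ 0ℤ) → ∑ l f ≡ 0ℤ
  ∑-zero []      f≡0 = refl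
  ∑-zero (x ∷ l) f≡0 = cong₂ _+_ (f≡0 x) (∑-zero l f≡0)

  ∑-+ : ∀ (l : List A) (f g : A → ℤ) → ∑[ x ∈ l ] (f x + g x) ≡ ∑ l f + ∑ l g
  ∑-+ []      f g = refl
  ∑-+ (x ∷ l) f g = trans (cong (_+_ (f x + g x)) (∑-+ l f g))
                          (interchange (f x) (g x) (∑ l f) (∑ l g))

  ∑-- : ∀ (l : List A) (f g : A → ℤ) → ∑[ x ∈ l ] (f x - g x) ≡ ∑ l f - ∑ l g
  ∑-- []      f g = refl
  ∑-- (x ∷ l) f g = trans (cong (_+_ (f x - g x)) (∑-- l f g))
                          (regroup (f x) (g x) (∑ l f) (∑ l g))
    where
    regroup : ∀ a b c d → a - b + (c - d) ≡ a + c - (b + d)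
    regroup = solve-∀

  ∑-*ˡ : ∀ (l : List A) k (f : A → ℤ) → ∑[ x ∈ l ] (k * f x) ≡ k * ∑ l f
  ∑-*ˡ []      k f = sym (ℤP.*-zeroʳ k)
  ∑-*ˡ (x ∷ l) k f = trans (cong (_+_ (k * f x)) (∑-*ˡ l k f))
                           (sym (ℤP.*-distribˡ-+ k (f x) (∑ l f)))

  ∑-*ʳ : ∀ (l : List A) k (f : A → ℤ) → ∑[ x ∈ l ] (f x * k) ≡ ∑ l f * k
  ∑-*ʳ l k f = trans (∑-cong l (λ x → ℤP.*-comm (f x) k))
                     (trans (∑-*ˡ l k f) (ℤP.*-comm k (∑ l f)))

  ∑-++ : ∀ (l m : List A) (f : A → ℤ) → ∑ (l ++ m) f ≡ ∑ l f + ∑ m f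
  ∑-++ []      m f = sym (ℤP.+-identityˡ (∑ m f))
  ∑-++ (x ∷ l) m f = trans (cong (_+_ (f x)) (∑-++ l m f)) (sym (ℤP.+-assoc (f x) _ _))

  ∑-map : ∀ {B : Set} (g : B → A) (l : List B) (f : A → ℤ) →
          ∑ (map g l) f ≡ ∑[ y ∈ l ] f (g y)
  ∑-map g []      f = refl
  ∑-map g (y ∷ l) f = cong (_+_ (f (g y))) (∑-map g l f)

  ∑-mapMaybe : ∀ {B : Set} (g : B → Maybe A) (l : List B) (f : A → ℤ) →
               ∑ (mapMaybe g l) f ≡ ∑[ y ∈ l ] maybe′ f 0ℤ (g y)
  ∑-mapMaybe g []      f = refl
  ∑-mapMaybe g (y ∷ l) f with g y
  ... | just x  = cong (_+_ (f x)) (∑-mapMaybe g l f)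
  ... | nothing = trans (∑-mapMaybe g l f) (sym (ℤP.+-identityˡ _))

∑-rescale : ∀ {X : Set} k (l : List (ℤ × X)) (g : X → ℤ) →
  k * ∑[ c ∈ l ] (proj₁ c * g (proj₂ c))
    ≡ ∑[ c ∈ map (λ c → k * proj₁ c , proj₂ c) l ] (proj₁ c * g (proj₂ c))
∑-rescale k l g = trans (sym (∑-*ˡ l k _))
  (trans (∑-cong l (λ c → sym (ℤP.*-assoc k (proj₁ c) _))) (sym (∑-map _ l _)))

χ-true : ∀ {b} → T b → χ b ≡ 1ℤ
χ-true {true} _ = refl

¬T⇒≡false : ∀ {b} → ¬ T b → b ≡ false
¬T⇒≡false {true}  ¬T = contradiction _ ¬T
¬T⇒≡false {false} _  = refl

allB-elim : ∀ {A : Set} {p : A → Bool} {l : List A} {x} → T (allB p l) → x ∈ l → T (p x)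
allB-elim         {l = y ∷ l} all (here refl) = proj₁ (Equivalence.to T-∧ all)
allB-elim {p = p} {l = y ∷ l} all (there x∈l) = allB-elim (proj₂ (Equivalence.to (T-∧ {p y}) all)) x∈l

<ᵇ-dichotomy : ∀ {n} {x y : Fin n} → x ≢ y →
    T (toℕ x <ᵇ toℕ y) × (toℕ y <ᵇ toℕ x) ≡ false
  ⊎ (toℕ x <ᵇ toℕ y) ≡ false × T (toℕ y <ᵇ toℕ x)
<ᵇ-dichotomy {x = x} {y} x≢y with ℕP.<-cmp (toℕ x) (toℕ y)
... | tri< x<y _ _ = inj₁ (ℕP.<⇒<ᵇ x<y , ¬T⇒≡false (ℕP.<-asym x<y ∘ ℕP.<ᵇ⇒< _ _))
... | tri≈ _ x≡y _ = contradiction (toℕ-injective x≡y) x≢y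
... | tri> _ _ y<x = inj₂ (¬T⇒≡false (ℕP.<-asym y<x ∘ ℕP.<ᵇ⇒< _ _) , ℕP.<⇒<ᵇ y<x)

record IsSifting {A : Set} (l : List A) (d : A → A → ℤ) : Set where
  field sift : ∀ a (f : A → ℤ) → ∑[ x ∈ l ] (d x a * f x) ≡ f a

open IsSifting

module _ {A B : Set} {l : List A} {m : List B} {d : A → A → ℤ} {e : B → B → ℤ} where

  ∑∑-sift : IsSifting l d → IsSifting m e → ∀ a b (f : A → B → ℤ) →
            ∑[ x ∈ l ] ∑[ y ∈ m ] (d x a * (e y b * f x y)) ≡ f a b
  ∑∑-sift l-sifts m-sifts a b f = begin
    ∑[ x ∈ l ] ∑[ y ∈ m ] (d x a * (e y b * f x y))
      ≡⟨ ∑-cong l (λ x → ∑-*ˡ m (d x a) _) ⟩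
    ∑[ x ∈ l ] (d x a * ∑[ y ∈ m ] (e y b * f x y))
      ≡⟨ ∑-cong l (λ x → cong (d x a *_) (sift m-sifts b (f x))) ⟩
    ∑[ x ∈ l ] (d x a * f x b)
      ≡⟨ sift l-sifts a (λ x → f x b) ⟩
    f a b ∎
    where open ≡-Reasoning

∑-allFin-suc : ∀ n (f : Fin (suc n) → ℤ) →
               ∑ (allFin (suc n)) f ≡ f Fin.zero + ∑[ i ∈ allFin n ] f (Fin.suc i)
∑-allFin-suc n f = cong (_+_ (f Fin.zero))
  (trans (cong (λ l → ∑ l f) (sym (map-tabulate id Fin.suc))) (∑-map Fin.suc (allFin n) f))

∑-allFin-single : ∀ {n} (v : Fin n) {f : Fin n → ℤ} →
                  (∀ x → x ≢ v → f x ≡ 0ℤ) → ∑ (allFin n) f ≡ f v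
∑-allFin-single {suc n} Fin.zero {f} f≡0 = begin
  ∑ (allFin (suc n)) f                        ≡⟨ ∑-allFin-suc n f ⟩
  f Fin.zero + ∑[ i ∈ allFin n ] f (Fin.suc i)
    ≡⟨ cong (_+_ (f Fin.zero)) (∑-zero (allFin n) (λ i → f≡0 (Fin.suc i) λ ())) ⟩
  f Fin.zero + 0ℤ                              ≡⟨ ℤP.+-identityʳ _ ⟩
  f Fin.zero                                   ∎
  where open ≡-Reasoning
∑-allFin-single {suc n} (Fin.suc v) {f} f≡0 = begin
  ∑ (allFin (suc n)) f                        ≡⟨ ∑-allFin-suc n f ⟩
  f Fin.zero + ∑[ i ∈ allFin n ] f (Fin.suc i)
    ≡⟨ cong₂ _+_ (f≡0 Fin.zero λ ())
                 (∑-allFin-single v λ x x≢v → f≡0 (Fin.suc x) (x≢v ∘ suc-injective)) ⟩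
  0ℤ + f (Fin.suc v)                           ≡⟨ ℤP.+-identityˡ _ ⟩
  f (Fin.suc v)                                ∎
  where open ≡-Reasoning

∑-allSubsets-suc : ∀ n (f : Subset (suc n) → ℤ) → ∑ (allSubsets (suc n)) f ≡
                   ∑[ E ∈ allSubsets n ] f (false ∷ E) + ∑[ E ∈ allSubsets n ] f (true ∷ E)
∑-allSubsets-suc n f =
  trans (∑-++ (map (false ∷_) (allSubsets n)) _ f)
        (cong₂ _+_ (∑-map (false ∷_) (allSubsets n) f) (∑-map (true ∷_) (allSubsets n) f))

∑-allSubsets-single : ∀ {n} (D : Subset n) {f : Subset n → ℤ} →
                      (∀ E → E ≢ D → f E ≡ 0ℤ) → ∑ (allSubsets n) f ≡ f D
∑-allSubsets-single {zero} [] f≡0 = ℤP.+-identityʳ _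
∑-allSubsets-single {suc n} (false ∷ D) {f} f≡0 = trans (∑-allSubsets-suc n f)
  (trans (cong₂ _+_ (∑-allSubsets-single D λ E E≢D → f≡0 _ (E≢D ∘ cong tail))
                    (∑-zero (allSubsets n) λ E → f≡0 _ (λ ())))
         (ℤP.+-identityʳ _))
∑-allSubsets-single {suc n} (true ∷ D) {f} f≡0 = trans (∑-allSubsets-suc n f)
  (trans (cong₂ _+_ (∑-zero (allSubsets n) λ E → f≡0 _ (λ ()))
                    (∑-allSubsets-single D λ E E≢D → f≡0 _ (E≢D ∘ cong tail)))
         (ℤP.+-identityˡ _))

∑-χ-lookup : ∀ {n} (C : Subset n) → ∑[ u ∈ allFin n ] χ (lookup C u) ≡ + ∣ C ∣
∑-χ-lookup {zero}  []      = refl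
∑-χ-lookup {suc n} (b ∷ C) = trans (∑-allFin-suc n (λ u → χ (lookup (b ∷ C) u))) (split b)
  where
  split : ∀ b → χ b + ∑[ u ∈ allFin n ] χ (lookup C u) ≡ + ∣ b ∷ C ∣
  split false = trans (ℤP.+-identityˡ _) (∑-χ-lookup C)
  split true  = cong (_+_ 1ℤ) (∑-χ-lookup C)

module Chains (G : Graph) where
  open Graph G

  infix  4 _≗_ _∼_
  infixl 6 _+ᵥ_ _-ᵥ_
  infixr 7 _·ᵥ_

  _+ᵥ_ _-ᵥ_ : EVec G → EVec G → EVec G
  _+ᵥ_ = _⊕_ G
  _-ᵥ_ = _⊖_ G

  _·ᵥ_ : ℤ → EVec G → EVec G
  _·ᵥ_ = _·_ G

  0ᵥ : EVec G
  0ᵥ = zeroV G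

  Σᵥ : {A : Set} → List A → (A → EVec G) → EVec G
  Σᵥ l F = vsum G (map F l)

  syntax Σᵥ l (λ x → F) = Σᵥ[ x ∈ l ] F

  _≗_ : EVec G → EVec G → Set
  f ≗ g = ∀ p q → f p q ≡ g p q

  ≗-refl : ∀ {f} → f ≗ f
  ≗-refl p q = refl

  ≗-sym : ∀ {f g} → f ≗ g → g ≗ f
  ≗-sym f≗g p q = sym (f≗g p q)

  ≗-trans : ∀ {f g h} → f ≗ g → g ≗ h → f ≗ h
  ≗-trans f≗g g≗h p q = trans (f≗g p q) (g≗h p q)

  ≗-isEquivalence : IsEquivalence _≗_
  ≗-isEquivalence = record { refl = ≗-refl ; sym = ≗-sym ; trans = ≗-trans }

  +ᵥ-cong : ∀ {f f′ g g′} → f ≗ f′ → g ≗ g′ → f +ᵥ g ≗ f′ +ᵥ g′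
  +ᵥ-cong f≗f′ g≗g′ p q = cong₂ _+_ (f≗f′ p q) (g≗g′ p q)

  ·ᵥ-cong : ∀ k {f g} → f ≗ g → k ·ᵥ f ≗ k ·ᵥ g
  ·ᵥ-cong k f≗g p q = cong (k *_) (f≗g p q)

  χ·ᵥ-cong : ∀ b {f g} → (b ≡ true → f ≗ g) → χ b ·ᵥ f ≗ χ b ·ᵥ g
  χ·ᵥ-cong true  f≗g = ·ᵥ-cong 1ℤ (f≗g refl)
  χ·ᵥ-cong false {f} {g} _ p q = trans (ℤP.*-zeroˡ (f p q)) (sym (ℤP.*-zeroˡ (g p q)))

  if-apply : ∀ b k (f : EVec G) p q →
             (if b then k ·ᵥ f else 0ᵥ) p q ≡ χ b * (k * f p q)
  if-apply true  k f p q = sym (ℤP.*-identityˡ _)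
  if-apply false k f p q = sym (ℤP.*-zeroˡ (k * f p q))

  vsum-apply : ∀ (fs : List (EVec G)) p q → vsum G fs p q ≡ ∑[ f ∈ fs ] f p q
  vsum-apply []       p q = refl
  vsum-apply (f ∷ fs) p q = cong (_+_ (f p q)) (vsum-apply fs p q)

  Σᵥ-apply : ∀ {A : Set} (l : List A) (F : A → EVec G) p q →
             Σᵥ l F p q ≡ ∑[ i ∈ l ] F i p q
  Σᵥ-apply l F p q = trans (vsum-apply (map F l) p q) (∑-map F l (λ f → f p q))

  Σᵥ₂-apply : ∀ {A B : Set} (l : List A) (m : List B) (F : A → B → EVec G) p q →
              (Σᵥ[ i ∈ l ] Σᵥ m (F i)) p q ≡ ∑[ i ∈ l ] ∑[ j ∈ m ] F i j p q
  Σᵥ₂-apply l m F p q = trans (Σᵥ-apply l _ p q) (∑-cong l λ i → Σᵥ-apply m (F i) p q)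

  Σᵥ-cong : ∀ {A : Set} (l : List A) {F F′ : A → EVec G} →
            (∀ i → F i ≗ F′ i) → Σᵥ l F ≗ Σᵥ l F′
  Σᵥ-cong []      F≗F′ = ≗-refl
  Σᵥ-cong (i ∷ l) F≗F′ = +ᵥ-cong (F≗F′ i) (Σᵥ-cong l F≗F′)

  Σᵥ-+ : ∀ {A : Set} (l : List A) (F F′ : A → EVec G) →
         Σᵥ[ i ∈ l ] (F i +ᵥ F′ i) ≗ Σᵥ l F +ᵥ Σᵥ l F′
  Σᵥ-+ l F F′ p q = begin
    (Σᵥ[ i ∈ l ] (F i +ᵥ F′ i)) p q           ≡⟨ Σᵥ-apply l _ p q ⟩
    ∑[ i ∈ l ] (F i p q + F′ i p q)           ≡⟨ ∑-+ l _ _ ⟩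
    ∑[ i ∈ l ] F i p q + ∑[ i ∈ l ] F′ i p q  ≡⟨ cong₂ _+_ (Σᵥ-apply l F p q) (Σᵥ-apply l F′ p q) ⟨
    Σᵥ l F p q + Σᵥ l F′ p q                  ∎
    where open ≡-Reasoning

  Σᵥ-· : ∀ {A : Set} (l : List A) k (F : A → EVec G) →
         Σᵥ[ i ∈ l ] (k ·ᵥ F i) ≗ k ·ᵥ Σᵥ l F
  Σᵥ-· l k F p q = trans (Σᵥ-apply l _ p q)
    (trans (∑-*ˡ l k (λ i → F i p q)) (cong (k *_) (sym (Σᵥ-apply l F p q))))

  Σᵥ-scalar : ∀ {A : Set} (l : List A) (c : A → ℤ) (f : EVec G) →
              Σᵥ[ i ∈ l ] (c i ·ᵥ f) ≗ ∑ l c ·ᵥ f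
  Σᵥ-scalar l c f p q = trans (Σᵥ-apply l _ p q) (∑-*ʳ l (f p q) c)

  δ-refl : ∀ x → δ G x x ≡ 1ℤ
  δ-refl x with x ≟ x
  ... | yes _   = refl
  ... | no  x≢x = contradiction refl x≢x

  δ-≢ : ∀ {x y} → x ≢ y → δ G x y ≡ 0ℤ
  δ-≢ {x} {y} x≢y with x ≟ y
  ... | yes x≡y = contradiction x≡y x≢y
  ... | no  _   = refl

  δ-sym : ∀ x y → δ G x y ≡ δ G y x
  δ-sym x y with x ≟ y | y ≟ x
  ... | yes _   | yes _   = refl
  ... | no  _   | no  _   = refl
  ... | yes x≡y | no  y≢x = contradiction (sym x≡y) y≢x
  ... | no  x≢y | yes y≡x = contradiction (sym y≡x) x≢y

  oedge-flip : ∀ x y → oedge G y x ≗ -1ℤ ·ᵥ oedge G x y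
  oedge-flip x y p q = flip (δ G p x) (δ G q y) (δ G p y) (δ G q x)
    where
    flip : ∀ a b c d → c * d - a * b ≡ -1ℤ * (a * b - c * d)
    flip = solve-∀

  oedge-self : ∀ x → oedge G x x ≗ 0ᵥ
  oedge-self x p q = ℤP.+-inverseʳ (δ G p x * δ G q x)

  oedge-transpose : ∀ x y p q → oedge G x y p q ≡ oedge G p q x y
  oedge-transpose x y p q =
    cong₂ _-_ (cong₂ _*_ (δ-sym p x) (δ-sym q y))
              (trans (ℤP.*-comm (δ G p y) (δ G q x)) (cong₂ _*_ (δ-sym q x) (δ-sym p y)))

  bondTerm : ℤ × V → EVec G
  bondTerm kv = proj₁ kv ·ᵥ bond G (proj₂ kv)

  cycleTerm : ℤ × Cycle G → EVec G
  cycleTerm kc = proj₁ kc ·ᵥ cycleVec G (proj₂ kc)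

  combination-apply : ∀ bs cs p q →
    vsum G (map bondTerm bs ++ map cycleTerm cs) p q
      ≡ ∑[ kv ∈ bs ] bondTerm kv p q + ∑[ kc ∈ cs ] cycleTerm kc p q
  combination-apply bs cs p q =
    trans (vsum-apply (map bondTerm bs ++ map cycleTerm cs) p q)
    (trans (∑-++ (map bondTerm bs) (map cycleTerm cs) (λ f → f p q))
           (cong₂ _+_ (∑-map bondTerm bs (λ f → f p q)) (∑-map cycleTerm cs (λ f → f p q))))

  span-cong : ∀ {f g} → f ≗ g → InBondPlusCycle G g → InBondPlusCycle G f
  span-cong f≗g (bs , cs , g≡) = bs , cs , λ p q → trans (f≗g p q) (g≡ p q)

  span-0 : InBondPlusCycle G 0ᵥ
  span-0 = [] , [] , λ p q → refl

  span-+ : ∀ {f g} → InBondPlusCycle G f → InBondPlusCycle G g → InBondPlusCycle G (f +ᵥ g)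
  span-+ {f} {g} (bs , cs , f≡) (bs′ , cs′ , g≡) = bs ++ bs′ , cs ++ cs′ , λ p q →
    let B l = ∑[ kv ∈ l ] bondTerm kv p q
        C l = ∑[ kc ∈ l ] cycleTerm kc p q
    in begin
    f p q + g p q                     ≡⟨ cong₂ _+_ (trans (f≡ p q) (combination-apply bs cs p q))
                                                   (trans (g≡ p q) (combination-apply bs′ cs′ p q)) ⟩
    (B bs + C cs) + (B bs′ + C cs′)   ≡⟨ interchange (B bs) (C cs) (B bs′) (C cs′) ⟩
    (B bs + B bs′) + (C cs + C cs′)   ≡⟨ sym (cong₂ _+_ (∑-++ bs bs′ _) (∑-++ cs cs′ _)) ⟩
    B (bs ++ bs′) + C (cs ++ cs′)     ≡⟨ sym (combination-apply (bs ++ bs′) (cs ++ cs′) p q) ⟩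
    vsum G (map bondTerm (bs ++ bs′) ++ map cycleTerm (cs ++ cs′)) p q ∎
    where open ≡-Reasoning

  span-· : ∀ k {f} → InBondPlusCycle G f → InBondPlusCycle G (k ·ᵥ f)
  span-· k {f} (bs , cs , f≡) = map rescale bs , map rescale cs , λ p q → begin
    k * f p q
      ≡⟨ cong (k *_) (trans (f≡ p q) (combination-apply bs cs p q)) ⟩
    k * (∑[ kv ∈ bs ] bondTerm kv p q + ∑[ kc ∈ cs ] cycleTerm kc p q)
      ≡⟨ ℤP.*-distribˡ-+ k _ _ ⟩
    k * ∑[ kv ∈ bs ] bondTerm kv p q + k * ∑[ kc ∈ cs ] cycleTerm kc p q
      ≡⟨ cong₂ _+_ (∑-rescale k bs _) (∑-rescale k cs _) ⟩
    ∑[ kv ∈ map rescale bs ] bondTerm kv p q + ∑[ kc ∈ map rescale cs ] cycleTerm kc p q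
      ≡⟨ combination-apply (map rescale bs) (map rescale cs) p q ⟨
    vsum G (map bondTerm (map rescale bs) ++ map cycleTerm (map rescale cs)) p q ∎
    where
    open ≡-Reasoning
    rescale : ∀ {X : Set} → ℤ × X → ℤ × X
    rescale c = k * proj₁ c , proj₂ c

  span-Σ : ∀ {A : Set} (l : List A) {F : A → EVec G} →
           (∀ i → InBondPlusCycle G (F i)) → InBondPlusCycle G (Σᵥ l F)
  span-Σ []      F∈ = span-0
  span-Σ (i ∷ l) F∈ = span-+ (F∈ i) (span-Σ l F∈)

  span-χ· : ∀ b {f} → (b ≡ true → InBondPlusCycle G f) → InBondPlusCycle G (χ b ·ᵥ f)
  span-χ· true  f∈ = span-· 1ℤ (f∈ refl)
  span-χ· false {f} _ = span-cong (λ p q → ℤP.*-zeroˡ (f p q)) span-0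

  span-bond : ∀ v → InBondPlusCycle G (bond G v)
  span-bond v = (1ℤ , v) ∷ [] , [] , λ p q → sym (trans (ℤP.+-identityʳ _) (ℤP.*-identityˡ _))

  span-cycle : ∀ c → InBondPlusCycle G (cycleVec G c)
  span-cycle c = [] , (1ℤ , c) ∷ [] , λ p q → sym (trans (ℤP.+-identityʳ _) (ℤP.*-identityˡ _))

  record _∼_ (f g : EVec G) : Set where
    constructor ∼-by
    field difference∈span : InBondPlusCycle G (f -ᵥ g)

  open _∼_ public

  ≗⇒∼ : ∀ {f g} → f ≗ g → f ∼ g
  ≗⇒∼ {f} {g} f≗g =
    ∼-by (span-cong (λ p q → trans (cong (_- g p q) (f≗g p q)) (ℤP.+-inverseʳ (g p q))) span-0)

  ∼-refl : ∀ {f} → f ∼ f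
  ∼-refl = ≗⇒∼ ≗-refl

  +ᵥ-span∼ : ∀ {f g} → InBondPlusCycle G g → f +ᵥ g ∼ f
  +ᵥ-span∼ {f} {g} g∈ = ∼-by (span-cong (λ p q → cancel (f p q) (g p q)) g∈)
    where
    cancel : ∀ a b → a + b - a ≡ b
    cancel = solve-∀

  ∼-trans : ∀ {f g h} → f ∼ g → g ∼ h → f ∼ h
  ∼-trans {f} {g} {h} (∼-by f-g∈) (∼-by g-h∈) =
    ∼-by (span-cong (λ p q → telescope (f p q) (g p q) (h p q)) (span-+ f-g∈ g-h∈))
    where
    telescope : ∀ a b c → a - c ≡ (a - b) + (b - c)
    telescope = solve-∀

  +ᵥ-cong∼ : ∀ {f f′ g g′} → f ∼ f′ → g ∼ g′ → f +ᵥ g ∼ f′ +ᵥ g′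
  +ᵥ-cong∼ {f} {f′} {g} {g′} (∼-by f-f′∈) (∼-by g-g′∈) =
    ∼-by (span-cong (λ p q → regroup (f p q) (f′ p q) (g p q) (g′ p q)) (span-+ f-f′∈ g-g′∈))
    where
    regroup : ∀ a a′ b b′ → a + b - (a′ + b′) ≡ (a - a′) + (b - b′)
    regroup = solve-∀

  ·ᵥ-cong∼ : ∀ k {f g} → f ∼ g → k ·ᵥ f ∼ k ·ᵥ g
  ·ᵥ-cong∼ k {f} {g} (∼-by f-g∈) =
    ∼-by (span-cong (λ p q → factor k (f p q) (g p q)) (span-· k f-g∈))
    where
    factor : ∀ k a b → k * a - k * b ≡ k * (a - b)
    factor = solve-∀

  Σᵥ-cong∼ : ∀ {A : Set} (l : List A) {F F′ : A → EVec G} →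
             (∀ i → F i ∼ F′ i) → Σᵥ l F ∼ Σᵥ l F′
  Σᵥ-cong∼ []      F∼F′ = ∼-refl
  Σᵥ-cong∼ (i ∷ l) F∼F′ = +ᵥ-cong∼ (F∼F′ i) (Σᵥ-cong∼ l F∼F′)

  ∼-preorder : Preorder 0ℓ 0ℓ 0ℓ
  ∼-preorder = record
    { Carrier    = EVec G
    ; _≈_        = _≗_
    ; _≲_        = _∼_
    ; isPreorder = record { isEquivalence = ≗-isEquivalence ; reflexive = ≗⇒∼ ; trans = ∼-trans }
    }

  module ∼-Reasoning = PreorderReasoning ∼-preorder

module _ (G H : Graph) where
  private
    module Dom = Chains G
    module Cod = Chains H

  record IsLinear (L : EVec G → EVec H) : Set where
    field
      ≗-cong : ∀ {f g} → f Dom.≗ g → L f Cod.≗ L g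
      +-homo : ∀ f g → L (f Dom.+ᵥ g) Cod.≗ L f Cod.+ᵥ L g
      ·-homo : ∀ k f → L (k Dom.·ᵥ f) Cod.≗ k Cod.·ᵥ L f

    0-homo : L Dom.0ᵥ Cod.≗ Cod.0ᵥ
    0-homo p q = trans (·-homo 0ℤ Dom.0ᵥ p q) (ℤP.*-zeroˡ (L Dom.0ᵥ p q))

    Σ-homo : ∀ {A : Set} (l : List A) (F : A → EVec G) →
             L (Dom.Σᵥ l F) Cod.≗ Cod.Σᵥ l (L ∘ F)
    Σ-homo []      F = 0-homo
    Σ-homo (i ∷ l) F p q =
      trans (+-homo (F i) (Dom.Σᵥ l F) p q) (cong (_+_ (L (F i) p q)) (Σ-homo l F p q))

  0-isLinear : IsLinear (λ _ → Cod.0ᵥ)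
  0-isLinear = record
    { ≗-cong = λ _ _ _ → refl
    ; +-homo = λ _ _ _ _ → refl
    ; ·-homo = λ k _ _ _ → sym (ℤP.*-zeroʳ k)
    }

  coordinate-isLinear : ∀ x y (X : EVec H) → IsLinear (λ f → f x y Cod.·ᵥ X)
  coordinate-isLinear x y X = record
    { ≗-cong = λ f≗g p q → cong (_* X p q) (f≗g x y)
    ; +-homo = λ f g p q → ℤP.*-distribʳ-+ (X p q) (f x y) (g x y)
    ; ·-homo = λ k f p q → ℤP.*-assoc k (f x y) (X p q)
    }

  Σ-isLinear : ∀ {A : Set} (l : List A) {T : A → EVec G → EVec H} →
               (∀ i → IsLinear (T i)) → IsLinear (λ f → Cod.Σᵥ l (λ i → T i f))
  Σ-isLinear l T-lin = record
    { ≗-cong = λ f≗g → Cod.Σᵥ-cong l (λ i → IsLinear.≗-cong (T-lin i) f≗g)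
    ; +-homo = λ f g → Cod.≗-trans (Cod.Σᵥ-cong l (λ i → IsLinear.+-homo (T-lin i) f g))
                                   (Cod.Σᵥ-+ l _ _)
    ; ·-homo = λ k f → Cod.≗-trans (Cod.Σᵥ-cong l (λ i → IsLinear.·-homo (T-lin i) k f))
                                   (Cod.Σᵥ-· l k _)
    }

module CliqueGraph (n : ℕ) (adj : Fin n → Fin n → Bool)
             (adj-sym : ∀ x y → adj x y ≡ adj y x)
             (adj-irr : ∀ x → adj x x ≡ false)
             (ω : ℕ) where

  open Setup n adj adj-sym adj-irr ω
  module S = Chains S
  module Γ = Chains Γ

  mem : Clique → Fin n → Bool
  mem C u = lookup (proj₁ C) u

  adj⇒≢ : ∀ {x y} → T (adj x y) → x ≢ y
  adj⇒≢ {x} e refl = subst T (adj-irr x) e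

  clique-size : ∀ (C : Clique) → ∣ proj₁ C ∣ ≡ ω
  clique-size (C , C-isClique) = ℕP.≡ᵇ⇒≡ _ _ (proj₁ (Equivalence.to T-∧ C-isClique))

  clique-count : ∀ (C : Clique) → ∑[ u ∈ allFin n ] χ (mem C u) ≡ + ω
  clique-count C = trans (∑-χ-lookup (proj₁ C)) (cong +_ (clique-size C))

  clique-adj : ∀ (C : Clique) {x y} → mem C x ≡ true → mem C y ≡ true → x ≢ y → T (adj x y)
  clique-adj (C , C-isClique) {x} {y} x∈C y∈C x≢y =
    members-adj (allB-elim (allB-elim (proj₂ (Equivalence.to (T-∧ {∣ C ∣ ≡ᵇ ω}) C-isClique))
                                      (∈-allFin x))
                           (∈-allFin y))
    where
    members-adj : T (not (lookup C x ∧ lookup C y ∧ not (does (x Fin.≟ y))) ∨ adj x y) → T (adj x y)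
    members-adj t rewrite x∈C | y∈C with x Fin.≟ y
    ... | yes x≡y = contradiction x≡y x≢y
    ... | no  _   = t

  ∑-cliques-single : ∀ (D : Clique) {f : Clique → ℤ} →
                     (∀ C → C ≢ D → f C ≡ 0ℤ) → ∑ cliques f ≡ f D
  ∑-cliques-single (D , D-isClique) {f} f≡0 = begin
    ∑ cliques f                                       ≡⟨ ∑-mapMaybe toClique (allSubsets n) f ⟩
    ∑[ E ∈ allSubsets n ] maybe′ f 0ℤ (toClique E)    ≡⟨ ∑-allSubsets-single D off-D ⟩
    maybe′ f 0ℤ (toClique D)                          ≡⟨ at-D ⟩
    f (D , D-isClique)                                ∎
    where
    open ≡-Reasoning
    off-D : ∀ E → E ≢ D → maybe′ f 0ℤ (toClique E) ≡ 0ℤ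
    off-D E E≢D with T? (isωClique E)
    ... | yes E-isClique = f≡0 (E , E-isClique) (E≢D ∘ cong proj₁)
    ... | no  _          = refl
    at-D : maybe′ f 0ℤ (toClique D) ≡ f (D , D-isClique)
    at-D with T? (isωClique D)
    ... | yes D-isClique′ = cong (λ c → f (D , c)) (T-irrelevant D-isClique′ D-isClique)
    ... | no  ¬D-isClique = contradiction D-isClique ¬D-isClique

  allFin-sifts : IsSifting (allFin n) (δ Γ)
  sift allFin-sifts a f = trans
    (∑-allFin-single a λ x x≢a → trans (cong (_* f x) (Γ.δ-≢ x≢a)) (ℤP.*-zeroˡ (f x)))
    (trans (cong (_* f a) (Γ.δ-refl a)) (ℤP.*-identityˡ (f a)))

  cliques-sifts : IsSifting cliques (λ C D → δ S (inj₂ C) (inj₂ D))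
  sift cliques-sifts D f = trans
    (∑-cliques-single D λ C C≢D →
       trans (cong (_* f C) (S.δ-≢ (C≢D ∘ inj₂-injective))) (ℤP.*-zeroˡ (f C)))
    (trans (cong (_* f D) (S.δ-refl (inj₂ D))) (ℤP.*-identityˡ (f D)))

  ∑∑-oedge : ∀ v u (g : Fin n → Fin n → ℤ) →
             ∑[ x ∈ allFin n ] ∑[ y ∈ allFin n ] (oedge Γ v u x y * g x y) ≡ g v u - g u v
  ∑∑-oedge v u g = begin
    ∑[ x ∈ allFin n ] ∑[ y ∈ allFin n ] (oedge Γ v u x y * g x y)
      ≡⟨ ∑-cong (allFin n) (λ x → trans (∑-cong (allFin n) (expand x)) (∑-- (allFin n) _ _)) ⟩
    ∑[ x ∈ allFin n ] (sifted v u x - sifted u v x)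
      ≡⟨ ∑-- (allFin n) _ _ ⟩
    ∑ (allFin n) (sifted v u) - ∑ (allFin n) (sifted u v)
      ≡⟨ cong₂ _-_ (∑∑-sift allFin-sifts allFin-sifts v u g)
                   (∑∑-sift allFin-sifts allFin-sifts u v g) ⟩
    g v u - g u v ∎
    where
    open ≡-Reasoning
    sifted : Fin n → Fin n → Fin n → ℤ
    sifted a b x = ∑[ y ∈ allFin n ] (δ Γ x a * (δ Γ y b * g x y))
    distribute : ∀ a b c d e → (a * b - c * d) * e ≡ a * (b * e) - c * (d * e)
    distribute = solve-∀
    expand : ∀ x y → oedge Γ v u x y * g x y
                     ≡ δ Γ x v * (δ Γ y u * g x y) - δ Γ x u * (δ Γ y v * g x y)
    expand x y = distribute (δ Γ x v) (δ Γ y u) (δ Γ x u) (δ Γ y v) (g x y)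

  h-isLinear : IsLinear S Γ h
  h-isLinear = Σ-isLinear S Γ (allFin n) λ v → Σ-isLinear S Γ cliques λ C → summand v C
    where
    summand : ∀ v C →
      IsLinear S Γ (λ b → if mem C v then b (inj₁ v) (inj₂ C) Γ.·ᵥ hBasis v C else Γ.0ᵥ)
    summand v C with mem C v
    ... | true  = coordinate-isLinear S Γ (inj₁ v) (inj₂ C) (hBasis v C)
    ... | false = 0-isLinear S Γ

  module h = IsLinear h-isLinear

  module _ (reg : CliqueRegular) where

    Cxy-∋ : ∀ {x y} (e : T (adj x y)) → mem (Cxy reg x y e) x ≡ true × mem (Cxy reg x y e) y ≡ true
    Cxy-∋ {x} {y} e with proj₁ (proj₂ (proj₂ reg x y e))
    ... | x∈C , y∈C = []=⇒lookup x∈C , []=⇒lookup y∈C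

    Cxy-unique : ∀ {x y} (e : T (adj x y)) {C} → mem C x ≡ true → mem C y ≡ true → Cxy reg x y e ≡ C
    Cxy-unique {x} {y} e {C} x∈C y∈C =
      proj₂ (proj₂ (proj₂ reg x y e)) (lookup⇒[]= x (proj₁ C) x∈C , lookup⇒[]= y (proj₁ C) y∈C)

  module Γ-side where
    open Γ

    hBasis-star : ∀ v C → hBasis v C ≗ Σᵥ[ u ∈ allFin n ] (χ (mem C u) ·ᵥ oedge Γ v u)
    hBasis-star v C = Σᵥ-cong (allFin n) summand
      where
      summand : ∀ u → (if mem C u ∧ not (does (u Fin.≟ v)) then oedge Γ v u else 0ᵥ)
                        ≗ χ (mem C u) ·ᵥ oedge Γ v u
      summand u with mem C u | u Fin.≟ v
      ... | false | _        = λ p q → sym (ℤP.*-zeroˡ (oedge Γ v u p q))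
      ... | true  | yes refl = λ p q → sym (trans (ℤP.*-identityˡ _) (oedge-self u p q))
      ... | true  | no  _    = λ p q → sym (ℤP.*-identityˡ _)

    h-oedge : ∀ v C → mem C v ≡ true → h (oedge S (inj₁ v) (inj₂ C)) ≗ hBasis v C
    h-oedge v C v∈C p q = begin
      h (oedge S (inj₁ v) (inj₂ C)) p q
        ≡⟨ Σᵥ₂-apply (allFin n) cliques summand p q ⟩
      ∑[ x ∈ allFin n ] ∑[ D ∈ cliques ] summand x D p q
        ≡⟨ ∑-cong (allFin n) (λ x → ∑-cong cliques (λ D → sifted x D)) ⟩
      ∑[ x ∈ allFin n ] ∑[ D ∈ cliques ]
        (δ Γ x v * (δ S (inj₂ D) (inj₂ C) * (χ (mem D x) * hBasis x D p q)))
        ≡⟨ ∑∑-sift allFin-sifts cliques-sifts v C _ ⟩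
      χ (mem C v) * hBasis v C p q
        ≡⟨ cong (λ b → χ b * hBasis v C p q) v∈C ⟩
      1ℤ * hBasis v C p q
        ≡⟨ ℤP.*-identityˡ _ ⟩
      hBasis v C p q ∎
      where
      open ≡-Reasoning
      summand : Fin n → Clique → EVec Γ
      summand x D = if mem D x then oedge S (inj₁ v) (inj₂ C) (inj₁ x) (inj₂ D) ·ᵥ hBasis x D else 0ᵥ
      regroup : ∀ c a b h → c * ((a * b - 0ℤ * 0ℤ) * h) ≡ a * (b * (c * h))
      regroup = solve-∀
      sifted : ∀ x D → summand x D p q
                       ≡ δ Γ x v * (δ S (inj₂ D) (inj₂ C) * (χ (mem D x) * hBasis x D p q))
      sifted x D = trans (if-apply (mem D x) (oedge S (inj₁ v) (inj₂ C) (inj₁ x) (inj₂ D))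
                                   (hBasis x D) p q)
                         (regroup (χ (mem D x)) (δ Γ x v) (δ S (inj₂ D) (inj₂ C)) (hBasis x D p q))

    triangle : Fin n → Fin n → Fin n → EVec Γ
    triangle x u y = oedge Γ x u +ᵥ (oedge Γ u y +ᵥ (oedge Γ y x +ᵥ 0ᵥ))

    triangle-span : ∀ C {x y u} → mem C x ≡ true → mem C y ≡ true → mem C u ≡ true → x ≢ y →
                    InBondPlusCycle Γ (triangle x u y)
    triangle-span C {x} {y} {u} x∈C y∈C u∈C x≢y with u Fin.≟ x | u Fin.≟ y
    ... | yes refl | _        =
      span-cong (λ p q → cancel (δ Γ p u) (δ Γ q u) (δ Γ p y) (δ Γ q y)) span-0
      where
      cancel : ∀ a b c d → a * b - a * b + (a * d - c * b + (c * b - a * d + 0ℤ)) ≡ 0ℤ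
      cancel = solve-∀
    ... | no _     | yes refl =
      span-cong (λ p q → cancel (δ Γ p x) (δ Γ q x) (δ Γ p u) (δ Γ q u)) span-0
      where
      cancel : ∀ a b c d → a * d - c * b + (c * d - c * d + (c * b - a * d + 0ℤ)) ≡ 0ℤ
      cancel = solve-∀
    ... | no u≢x   | no u≢y   = span-cycle (mkCycle x (u ∷ y ∷ []) distinct adjacent)
      where
      distinct : Unique (x ∷ u ∷ y ∷ [])
      distinct = ((u≢x ∘ sym) ∷ x≢y ∷ []) ∷ (u≢y ∷ []) ∷ [] ∷ []
      adjacent : All (λ e → T (adj (proj₁ e) (proj₂ e))) (pairsOf Γ x (u ∷ y ∷ []))
      adjacent = clique-adj C x∈C u∈C (u≢x ∘ sym) ∷ clique-adj C u∈C y∈C u≢y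
               ∷ clique-adj C y∈C x∈C (x≢y ∘ sym) ∷ []

    hBasis-difference : ∀ C x y →
      hBasis x C +ᵥ -1ℤ ·ᵥ hBasis y C
        ≗ + ω ·ᵥ oedge Γ x y +ᵥ Σᵥ[ u ∈ allFin n ] (χ (mem C u) ·ᵥ triangle x u y)
    hBasis-difference C x y = begin-equality
      hBasis x C +ᵥ -1ℤ ·ᵥ hBasis y C
        ≈⟨ +ᵥ-cong (hBasis-star x C)
                   (≗-trans (·ᵥ-cong -1ℤ (hBasis-star y C)) (≗-sym (Σᵥ-· (allFin n) -1ℤ _))) ⟩
      Σᵥ[ u ∈ allFin n ] (χ (mem C u) ·ᵥ oedge Γ x u)
        +ᵥ Σᵥ[ u ∈ allFin n ] (-1ℤ ·ᵥ (χ (mem C u) ·ᵥ oedge Γ y u))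
        ≈⟨ Σᵥ-+ (allFin n) _ _ ⟨
      Σᵥ[ u ∈ allFin n ] (χ (mem C u) ·ᵥ oedge Γ x u +ᵥ -1ℤ ·ᵥ (χ (mem C u) ·ᵥ oedge Γ y u))
        ≈⟨ Σᵥ-cong (allFin n) detour ⟩
      Σᵥ[ u ∈ allFin n ] (χ (mem C u) ·ᵥ oedge Γ x y +ᵥ χ (mem C u) ·ᵥ triangle x u y)
        ≈⟨ Σᵥ-+ (allFin n) _ _ ⟩
      Σᵥ[ u ∈ allFin n ] (χ (mem C u) ·ᵥ oedge Γ x y)
        +ᵥ Σᵥ[ u ∈ allFin n ] (χ (mem C u) ·ᵥ triangle x u y)
        ≈⟨ +ᵥ-cong (≗-trans (Σᵥ-scalar (allFin n) _ (oedge Γ x y))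
                            (λ p q → cong (_* oedge Γ x y p q) (clique-count C))) ≗-refl ⟩
      + ω ·ᵥ oedge Γ x y +ᵥ Σᵥ[ u ∈ allFin n ] (χ (mem C u) ·ᵥ triangle x u y) ∎
      where
      open ∼-Reasoning
      rearrange : ∀ c a b d e f g → c * (a * b - d * e) + -1ℤ * (c * (f * b - d * g))
                  ≡ c * (a * g - f * e) + c * (a * b - d * e + (d * g - f * b + (f * e - a * g + 0ℤ)))
      rearrange = solve-∀
      detour : ∀ u → χ (mem C u) ·ᵥ oedge Γ x u +ᵥ -1ℤ ·ᵥ (χ (mem C u) ·ᵥ oedge Γ y u)
                     ≗ χ (mem C u) ·ᵥ oedge Γ x y +ᵥ χ (mem C u) ·ᵥ triangle x u y
      detour u p q = rearrange (χ (mem C u)) (δ Γ p x) (δ Γ q u) (δ Γ p u) (δ Γ q x) (δ Γ p y) (δ Γ q y)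

    -- Each edge is taken once, oriented x < y as in hᵀ.
    chain-decomposition : ∀ a → IsChain Γ a →
      a ≗ Σᵥ[ x ∈ allFin n ] Σᵥ[ y ∈ allFin n ] ((χ (toℕ x <ᵇ toℕ y) * a x y) ·ᵥ oedge Γ x y)
    chain-decomposition a (antisym , support) p q = sym (begin
      (Σᵥ[ x ∈ allFin n ] Σᵥ[ y ∈ allFin n ] (forward x y ·ᵥ oedge Γ x y)) p q
        ≡⟨ Σᵥ₂-apply (allFin n) (allFin n) (λ x y → forward x y ·ᵥ oedge Γ x y) p q ⟩
      ∑[ x ∈ allFin n ] ∑[ y ∈ allFin n ] (forward x y * oedge Γ x y p q)
        ≡⟨ ∑-cong (allFin n) (λ x → ∑-cong (allFin n) λ y →
             trans (ℤP.*-comm (forward x y) _) (cong (_* forward x y) (oedge-transpose x y p q))) ⟩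
      ∑[ x ∈ allFin n ] ∑[ y ∈ allFin n ] (oedge Γ p q x y * forward x y)
        ≡⟨ ∑∑-oedge p q forward ⟩
      forward p q - forward q p
        ≡⟨ one-orientation ⟩
      a p q ∎)
      where
      open ≡-Reasoning
      forward : Fin n → Fin n → ℤ
      forward x y = χ (toℕ x <ᵇ toℕ y) * a x y
      one-orientation : forward p q - forward q p ≡ a p q
      one-orientation with p Fin.≟ q
      ... | yes refl = trans (ℤP.+-inverseʳ (forward p p)) (sym (support p p (adj-irr p)))
      ... | no p≢q with <ᵇ-dichotomy p≢q
      ...   | inj₁ (p<q , q≮p) =
              trans (cong₂ (λ s t → s * a p q - t * a q p) (χ-true p<q) (cong χ q≮p))
                    (keep-first (a p q) (a q p))
        where
        keep-first : ∀ b c → 1ℤ * b - 0ℤ * c ≡ b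
        keep-first = solve-∀
      ...   | inj₂ (p≮q , q<p) =
              trans (cong₂ (λ s t → s * a p q - t * a q p) (cong χ p≮q) (χ-true q<p))
                    (trans (keep-second (a p q) (a q p)) (sym (antisym p q)))
        where
        keep-second : ∀ b c → 0ℤ * b - 1ℤ * c ≡ - c
        keep-second = solve-∀

    module _ (reg : CliqueRegular) where

      h-hᵀBasis∼ : ∀ x y (e : T (adj x y)) → h (hᵀBasis reg x y e) ∼ + ω ·ᵥ oedge Γ x y
      h-hᵀBasis∼ x y e = begin
        h (hᵀBasis reg x y e)
          ≈⟨ h-hᵀBasis ⟩
        hBasis x C +ᵥ -1ℤ ·ᵥ hBasis y C
          ≈⟨ hBasis-difference C x y ⟩
        + ω ·ᵥ oedge Γ x y +ᵥ Σᵥ[ u ∈ allFin n ] (χ (mem C u) ·ᵥ triangle x u y)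
          ≲⟨ +ᵥ-span∼ (span-Σ (allFin n) triangle-term) ⟩
        + ω ·ᵥ oedge Γ x y ∎
        where
        open ∼-Reasoning
        C : Clique
        C = Cxy reg x y e
        x∈C : mem C x ≡ true
        x∈C = proj₁ (Cxy-∋ reg e)
        y∈C : mem C y ≡ true
        y∈C = proj₂ (Cxy-∋ reg e)
        triangle-term : ∀ u → InBondPlusCycle Γ (χ (mem C u) ·ᵥ triangle x u y)
        triangle-term u = span-χ· (mem C u) (λ u∈C → triangle-span C x∈C y∈C u∈C (adj⇒≢ e))
        h-hᵀBasis : h (hᵀBasis reg x y e) ≗ hBasis x C +ᵥ -1ℤ ·ᵥ hBasis y C
        h-hᵀBasis = ≗-trans (h.+-homo (oedge S (inj₁ x) (inj₂ C)) (oedge S (inj₂ C) (inj₁ y)))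
          (+ᵥ-cong (h-oedge x C x∈C)
                   (≗-trans (h.≗-cong (S.oedge-flip (inj₁ y) (inj₂ C)))
                            (≗-trans (h.·-homo -1ℤ (oedge S (inj₁ y) (inj₂ C)))
                                     (·ᵥ-cong -1ℤ (h-oedge y C y∈C)))))

      h-hᵀTerm∼ : ∀ {a} → IsChain Γ a → ∀ x y →
                  h (hᵀTerm reg a x y) ∼ + ω ·ᵥ ((χ (toℕ x <ᵇ toℕ y) * a x y) ·ᵥ oedge Γ x y)
      h-hᵀTerm∼ {a} (_ , support) x y with toℕ x <ᵇ toℕ y | T? (adj x y)
      ... | true  | yes e = begin
        h (a x y S.·ᵥ hᵀBasis reg x y e)      ≈⟨ h.·-homo (a x y) (hᵀBasis reg x y e) ⟩
        a x y ·ᵥ h (hᵀBasis reg x y e)        ≲⟨ ·ᵥ-cong∼ (a x y) (h-hᵀBasis∼ x y e) ⟩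
        a x y ·ᵥ (+ ω ·ᵥ oedge Γ x y)         ≈⟨ (λ p q → commute (a x y) (+ ω) (oedge Γ x y p q)) ⟩
        + ω ·ᵥ ((1ℤ * a x y) ·ᵥ oedge Γ x y)  ∎
        where
        open ∼-Reasoning
        commute : ∀ c w o → c * (w * o) ≡ w * ((1ℤ * c) * o)
        commute = solve-∀
      ... | true  | no ¬e = ≗⇒∼ λ p q →
        trans (h.0-homo p q) (sym (vanish (+ ω) (oedge Γ x y p q) (support x y (¬T⇒≡false ¬e))))
        where
        vanish : ∀ w o {c} → c ≡ 0ℤ → w * ((1ℤ * c) * o) ≡ 0ℤ
        vanish w o refl = ℤP.*-zeroʳ w
      ... | false | _     = ≗⇒∼ λ p q → trans (h.0-homo p q) (sym (ℤP.*-zeroʳ (+ ω)))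

      hhᵀ∼ω : ∀ a → IsChain Γ a → h (hᵀ reg a) ∼ + ω ·ᵥ a
      hhᵀ∼ω a a-chain = begin
        h (hᵀ reg a)
          ≈⟨ h.Σ-homo (allFin n) _ ⟩
        Σᵥ[ x ∈ allFin n ] h (S.Σᵥ (allFin n) (hᵀTerm reg a x))
          ≈⟨ Σᵥ-cong (allFin n) (λ x → h.Σ-homo (allFin n) (hᵀTerm reg a x)) ⟩
        Σᵥ[ x ∈ allFin n ] Σᵥ[ y ∈ allFin n ] h (hᵀTerm reg a x y)
          ≲⟨ Σᵥ-cong∼ (allFin n) (λ x → Σᵥ-cong∼ (allFin n) (h-hᵀTerm∼ a-chain x)) ⟩
        Σᵥ[ x ∈ allFin n ] Σᵥ[ y ∈ allFin n ] (+ ω ·ᵥ (forward x y ·ᵥ oedge Γ x y))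
          ≈⟨ Σᵥ-cong (allFin n) (λ x → Σᵥ-· (allFin n) (+ ω) _) ⟩
        Σᵥ[ x ∈ allFin n ] (+ ω ·ᵥ Σᵥ[ y ∈ allFin n ] (forward x y ·ᵥ oedge Γ x y))
          ≈⟨ Σᵥ-· (allFin n) (+ ω) _ ⟩
        + ω ·ᵥ Σᵥ[ x ∈ allFin n ] Σᵥ[ y ∈ allFin n ] (forward x y ·ᵥ oedge Γ x y)
          ≈⟨ ·ᵥ-cong (+ ω) (chain-decomposition a a-chain) ⟨
        + ω ·ᵥ a ∎
        where
        open ∼-Reasoning
        forward : Fin n → Fin n → ℤ
        forward x y = χ (toℕ x <ᵇ toℕ y) * a x y

  module S-side where
    open S

    δ·χ-mem : ∀ a C D → δ S (inj₂ D) (inj₂ C) * χ (mem C a)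
                        ≡ (if mem D a then δ S (inj₂ D) (inj₂ C) else 0ℤ)
    δ·χ-mem a C D with Clique-≟ D C  -- which also decides δ S (inj₂ D) (inj₂ C)
    ... | yes refl with mem D a
    ...   | true  = refl
    ...   | false = refl
    δ·χ-mem a C D | no _ with mem D a
    ...   | true  = ℤP.*-zeroˡ (χ (mem C a))
    ...   | false = ℤP.*-zeroˡ (χ (mem C a))

    bond-clique : ∀ C →
      bond S (inj₂ C) ≗ Σᵥ[ u ∈ allFin n ] (χ (mem C u) ·ᵥ oedge S (inj₂ C) (inj₁ u))
    bond-clique C p q = sym (trans (Σᵥ-apply (allFin n) _ p q) (entry p q))
      where
      open ≡-Reasoning
      entry : ∀ p q →
        ∑[ u ∈ allFin n ] (χ (mem C u) * oedge S (inj₂ C) (inj₁ u) p q) ≡ bond S (inj₂ C) p q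
      entry (inj₁ a) (inj₁ a′) = ∑-zero (allFin n) λ u → vanish (χ (mem C u)) (δ Γ a′ u) (δ Γ a u)
        where
        vanish : ∀ c d d′ → c * (0ℤ * d - d′ * 0ℤ) ≡ 0ℤ
        vanish = solve-∀
      entry (inj₂ D) (inj₂ D′) = ∑-zero (allFin n) λ u →
        vanish (χ (mem C u)) (δ S (inj₂ D) (inj₂ C)) (δ S (inj₂ D′) (inj₂ C))
        where
        vanish : ∀ c d d′ → c * (d * 0ℤ - 0ℤ * d′) ≡ 0ℤ
        vanish = solve-∀
      entry (inj₁ a) (inj₂ D) = begin
        ∑[ u ∈ allFin n ] (χ (mem C u) * (0ℤ * 0ℤ - δ Γ a u * δ S (inj₂ D) (inj₂ C)))
          ≡⟨ ∑-cong (allFin n) (λ u → trans (reorder (χ (mem C u)) (δ Γ a u) (δ S (inj₂ D) (inj₂ C)))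
                                             (cong (λ d → d * - (δ S (inj₂ D) (inj₂ C) * χ (mem C u)))
                                                   (Γ.δ-sym a u))) ⟩
        ∑[ u ∈ allFin n ] (δ Γ u a * - (δ S (inj₂ D) (inj₂ C) * χ (mem C u)))
          ≡⟨ sift allFin-sifts a _ ⟩
        - (δ S (inj₂ D) (inj₂ C) * χ (mem C a))
          ≡⟨ cong -_ (δ·χ-mem a C D) ⟩
        - (if mem D a then δ S (inj₂ D) (inj₂ C) else 0ℤ)
          ≡⟨ negate (mem D a) ⟩
        bond S (inj₂ C) (inj₁ a) (inj₂ D) ∎
        where
        reorder : ∀ c d e → c * (0ℤ * 0ℤ - d * e) ≡ d * - (e * c)
        reorder = solve-∀
        negate : ∀ b → - (if b then δ S (inj₂ D) (inj₂ C) else 0ℤ)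
                         ≡ (if b then 0ℤ - δ S (inj₂ D) (inj₂ C) else 0ℤ)
        negate true  = sym (ℤP.+-identityˡ _)
        negate false = refl
      entry (inj₂ D) (inj₁ a) = begin
        ∑[ u ∈ allFin n ] (χ (mem C u) * (δ S (inj₂ D) (inj₂ C) * δ Γ a u - 0ℤ * 0ℤ))
          ≡⟨ ∑-cong (allFin n) (λ u → trans (reorder (χ (mem C u)) (δ S (inj₂ D) (inj₂ C)) (δ Γ a u))
                                             (cong (λ d → d * (δ S (inj₂ D) (inj₂ C) * χ (mem C u)))
                                                   (Γ.δ-sym a u))) ⟩
        ∑[ u ∈ allFin n ] (δ Γ u a * (δ S (inj₂ D) (inj₂ C) * χ (mem C u)))
          ≡⟨ sift allFin-sifts a _ ⟩
        δ S (inj₂ D) (inj₂ C) * χ (mem C a)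
          ≡⟨ δ·χ-mem a C D ⟩
        (if mem D a then δ S (inj₂ D) (inj₂ C) else 0ℤ)
          ≡⟨ drop-zero (mem D a) ⟩
        bond S (inj₂ C) (inj₂ D) (inj₁ a) ∎
        where
        reorder : ∀ c e d → c * (e * d - 0ℤ * 0ℤ) ≡ d * (e * c)
        reorder = solve-∀
        drop-zero : ∀ b → (if b then δ S (inj₂ D) (inj₂ C) else 0ℤ)
                            ≡ (if b then δ S (inj₂ D) (inj₂ C) - 0ℤ else 0ℤ)
        drop-zero true  = sym (ℤP.+-identityʳ _)
        drop-zero false = refl

    S-chain-decomposition : ∀ b → IsChain S b →
      b ≗ Σᵥ[ v ∈ allFin n ] Σᵥ[ C ∈ cliques ]
            (if mem C v then b (inj₁ v) (inj₂ C) ·ᵥ oedge S (inj₁ v) (inj₂ C) else 0ᵥ)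
    S-chain-decomposition b (antisym , support) p q = sym (begin
      (Σᵥ[ v ∈ allFin n ] Σᵥ[ C ∈ cliques ] component v C) p q
        ≡⟨ Σᵥ₂-apply (allFin n) cliques component p q ⟩
      ∑[ v ∈ allFin n ] ∑[ C ∈ cliques ] component v C p q
        ≡⟨ ∑-cong (allFin n) (λ v → ∑-cong cliques λ C →
             if-apply (mem C v) (b (inj₁ v) (inj₂ C)) (oedge S (inj₁ v) (inj₂ C)) p q) ⟩
      ∑[ v ∈ allFin n ] ∑[ C ∈ cliques ]
        (χ (mem C v) * (b (inj₁ v) (inj₂ C) * oedge S (inj₁ v) (inj₂ C) p q))
        ≡⟨ entry p q ⟩
      b p q ∎)
      where
      open ≡-Reasoning
      component : Fin n → Clique → EVec S
      component v C = if mem C v then b (inj₁ v) (inj₂ C) ·ᵥ oedge S (inj₁ v) (inj₂ C) else 0ᵥ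
      g : Fin n → Clique → ℤ
      g v C = χ (mem C v) * b (inj₁ v) (inj₂ C)
      on-clique : ∀ a D → g a D ≡ b (inj₁ a) (inj₂ D)
      on-clique a D with mem D a in a∈D
      ... | true  = ℤP.*-identityˡ _
      ... | false = trans (ℤP.*-zeroˡ (b (inj₁ a) (inj₂ D))) (sym (support (inj₁ a) (inj₂ D) a∈D))
      entry : ∀ p q → ∑[ v ∈ allFin n ] ∑[ C ∈ cliques ]
                        (χ (mem C v) * (b (inj₁ v) (inj₂ C) * oedge S (inj₁ v) (inj₂ C) p q))
                      ≡ b p q
      entry (inj₁ a) (inj₁ a′) =
        trans (∑-zero (allFin n) λ v → ∑-zero cliques λ C →
                 vanish (χ (mem C v)) (b (inj₁ v) (inj₂ C)) (δ Γ a v) (δ Γ a′ v))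
              (sym (support (inj₁ a) (inj₁ a′) refl))
        where
        vanish : ∀ c k d d′ → c * (k * (d * 0ℤ - 0ℤ * d′)) ≡ 0ℤ
        vanish = solve-∀
      entry (inj₂ D) (inj₂ D′) =
        trans (∑-zero (allFin n) λ v → ∑-zero cliques λ C →
                 vanish (χ (mem C v)) (b (inj₁ v) (inj₂ C))
                        (δ S (inj₂ D′) (inj₂ C)) (δ S (inj₂ D) (inj₂ C)))
              (sym (support (inj₂ D) (inj₂ D′) refl))
        where
        vanish : ∀ c k d d′ → c * (k * (0ℤ * d - d′ * 0ℤ)) ≡ 0ℤ
        vanish = solve-∀
      entry (inj₁ a) (inj₂ D) =
        trans (∑-cong (allFin n) λ v → ∑-cong cliques λ C →
                 trans (regroup (χ (mem C v)) (b (inj₁ v) (inj₂ C)) (δ Γ a v) (δ S (inj₂ D) (inj₂ C)))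
                       (cong₂ (λ d e → d * (e * g v C)) (Γ.δ-sym a v) (δ-sym (inj₂ D) (inj₂ C))))
        (trans (∑∑-sift allFin-sifts cliques-sifts a D g) (on-clique a D))
        where
        regroup : ∀ c k d e → c * (k * (d * e - 0ℤ * 0ℤ)) ≡ d * (e * (c * k))
        regroup = solve-∀
      entry (inj₂ D) (inj₁ a) =
        trans (∑-cong (allFin n) λ v → ∑-cong cliques λ C →
                 trans (regroup (χ (mem C v)) (b (inj₁ v) (inj₂ C)) (δ Γ a v) (δ S (inj₂ D) (inj₂ C)))
                       (cong₂ (λ d e → d * (e * - g v C)) (Γ.δ-sym a v) (δ-sym (inj₂ D) (inj₂ C))))
        (trans (∑∑-sift allFin-sifts cliques-sifts a D (λ v C → - g v C))
               (trans (cong -_ (on-clique a D)) (sym (antisym (inj₂ D) (inj₁ a)))))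
        where
        regroup : ∀ c k d e → c * (k * (0ℤ * 0ℤ - e * d)) ≡ d * (e * - (c * k))
        regroup = solve-∀

    module _ (reg : CliqueRegular) where

      hᵀ-isLinear : IsLinear Γ S (hᵀ reg)
      hᵀ-isLinear = Σ-isLinear Γ S (allFin n) λ x → Σ-isLinear Γ S (allFin n) λ y → summand x y
        where
        summand : ∀ x y → IsLinear Γ S (λ a → hᵀTerm reg a x y)
        summand x y with toℕ x <ᵇ toℕ y | T? (adj x y)
        ... | true  | yes e = coordinate-isLinear Γ S x y (hᵀBasis reg x y e)
        ... | true  | no  _ = 0-isLinear Γ S
        ... | false | _     = 0-isLinear Γ S

      module hᵀ = IsLinear hᵀ-isLinear

      -- hᵀ (x , y) if x < y are adjacent, and 0 otherwise.
      hᵀ-pair : Fin n → Fin n → EVec S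
      hᵀ-pair = hᵀTerm reg (λ _ _ → 1ℤ)

      hᵀTerm-factor : ∀ a x y → hᵀTerm reg a x y ≗ a x y ·ᵥ hᵀ-pair x y
      hᵀTerm-factor a x y with toℕ x <ᵇ toℕ y | T? (adj x y)
      ... | true  | yes e = λ p q → cong (a x y *_) (sym (ℤP.*-identityˡ _))
      ... | true  | no  _ = λ p q → sym (ℤP.*-zeroʳ (a x y))
      ... | false | _     = λ p q → sym (ℤP.*-zeroʳ (a x y))

      hᵀ-pair-forward : ∀ x y → T (toℕ x <ᵇ toℕ y) → (e : T (adj x y)) →
                        hᵀ-pair x y ≗ hᵀBasis reg x y e
      hᵀ-pair-forward x y x<y e with toℕ x <ᵇ toℕ y | T? (adj x y)
      ... | true  | yes e′ = λ p q →
        trans (ℤP.*-identityˡ _) (cong (λ e″ → hᵀBasis reg x y e″ p q) (T-irrelevant e′ e))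
      ... | true  | no ¬e  = contradiction e ¬e
      ... | false | _      = ⊥-elim x<y

      hᵀ-pair-backward : ∀ x y → (toℕ x <ᵇ toℕ y) ≡ false → hᵀ-pair x y ≗ 0ᵥ
      hᵀ-pair-backward x y x≮y with toℕ x <ᵇ toℕ y | T? (adj x y)
      ... | true  | yes _ = contradiction x≮y λ ()
      ... | true  | no  _ = ≗-refl
      ... | false | _     = ≗-refl

      hᵀBasis-clique : ∀ {x y} (e : T (adj x y)) C → mem C x ≡ true → mem C y ≡ true →
                       hᵀBasis reg x y e ≡ oedge S (inj₁ x) (inj₂ C) +ᵥ oedge S (inj₂ C) (inj₁ y)
      hᵀBasis-clique {x} {y} e C x∈C y∈C =
        cong (λ D → oedge S (inj₁ x) (inj₂ D) +ᵥ oedge S (inj₂ D) (inj₁ y))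
             (Cxy-unique reg e x∈C y∈C)

      hᵀ-pair-difference : ∀ C {v u} → mem C v ≡ true → mem C u ≡ true → v ≢ u →
        hᵀ-pair v u -ᵥ hᵀ-pair u v ≗ oedge S (inj₁ v) (inj₂ C) +ᵥ oedge S (inj₂ C) (inj₁ u)
      hᵀ-pair-difference C {v} {u} v∈C u∈C v≢u p q with <ᵇ-dichotomy v≢u
      ... | inj₁ (v<u , u≮v) = begin
        hᵀ-pair v u p q - hᵀ-pair u v p q
          ≡⟨ cong₂ _-_ (hᵀ-pair-forward v u v<u e p q) (hᵀ-pair-backward u v u≮v p q) ⟩
        hᵀBasis reg v u e p q - 0ℤ
          ≡⟨ ℤP.+-identityʳ _ ⟩
        hᵀBasis reg v u e p q
          ≡⟨ cong (λ f → f p q) (hᵀBasis-clique e C v∈C u∈C) ⟩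
        oedge S (inj₁ v) (inj₂ C) p q + oedge S (inj₂ C) (inj₁ u) p q ∎
        where
        open ≡-Reasoning
        e : T (adj v u)
        e = clique-adj C v∈C u∈C v≢u
      ... | inj₂ (v≮u , u<v) = begin
        hᵀ-pair v u p q - hᵀ-pair u v p q
          ≡⟨ cong₂ _-_ (hᵀ-pair-backward v u v≮u p q) (hᵀ-pair-forward u v u<v e p q) ⟩
        0ℤ - hᵀBasis reg u v e p q
          ≡⟨ cong (λ f → 0ℤ - f p q) (hᵀBasis-clique e C u∈C v∈C) ⟩
        0ℤ - (oedge S (inj₁ u) (inj₂ C) p q + oedge S (inj₂ C) (inj₁ v) p q)
          ≡⟨ cong₂ (λ s t → 0ℤ - (s + t)) (oedge-flip (inj₂ C) (inj₁ u) p q)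
                                          (oedge-flip (inj₁ v) (inj₂ C) p q) ⟩
        0ℤ - (-1ℤ * oedge S (inj₂ C) (inj₁ u) p q + -1ℤ * oedge S (inj₁ v) (inj₂ C) p q)
          ≡⟨ reverse (oedge S (inj₂ C) (inj₁ u) p q) (oedge S (inj₁ v) (inj₂ C) p q) ⟩
        oedge S (inj₁ v) (inj₂ C) p q + oedge S (inj₂ C) (inj₁ u) p q ∎
        where
        open ≡-Reasoning
        e : T (adj u v)
        e = clique-adj C u∈C v∈C (v≢u ∘ sym)
        reverse : ∀ s t → 0ℤ - (-1ℤ * s + -1ℤ * t) ≡ t + s
        reverse = solve-∀

      hᵀ-oedge : ∀ C {v u} → mem C v ≡ true → mem C u ≡ true →
                 hᵀ reg (oedge Γ v u) ≗ oedge S (inj₁ v) (inj₂ C) +ᵥ oedge S (inj₂ C) (inj₁ u)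
      hᵀ-oedge C {v} {u} v∈C u∈C with v Fin.≟ u
      ... | yes refl = λ p q → trans (hᵀ.≗-cong (Γ.oedge-self v) p q)
                                (trans (hᵀ.0-homo p q)
                                       (sym (trans (cong (_+_ (oedge S (inj₁ v) (inj₂ C) p q))
                                                         (oedge-flip (inj₁ v) (inj₂ C) p q))
                                                   (cancel (oedge S (inj₁ v) (inj₂ C) p q)))))
        where
        cancel : ∀ s → s + -1ℤ * s ≡ 0ℤ
        cancel = solve-∀
      ... | no v≢u = λ p q → begin
        hᵀ reg (oedge Γ v u) p q
          ≡⟨ Σᵥ₂-apply (allFin n) (allFin n) (hᵀTerm reg (oedge Γ v u)) p q ⟩
        ∑[ x ∈ allFin n ] ∑[ y ∈ allFin n ] hᵀTerm reg (oedge Γ v u) x y p q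
          ≡⟨ ∑-cong (allFin n) (λ x → ∑-cong (allFin n) λ y → hᵀTerm-factor (oedge Γ v u) x y p q) ⟩
        ∑[ x ∈ allFin n ] ∑[ y ∈ allFin n ] (oedge Γ v u x y * hᵀ-pair x y p q)
          ≡⟨ ∑∑-oedge v u (λ x y → hᵀ-pair x y p q) ⟩
        hᵀ-pair v u p q - hᵀ-pair u v p q
          ≡⟨ hᵀ-pair-difference C v∈C u∈C v≢u p q ⟩
        oedge S (inj₁ v) (inj₂ C) p q + oedge S (inj₂ C) (inj₁ u) p q ∎
        where open ≡-Reasoning

      hᵀ-hBasis : ∀ v C → mem C v ≡ true →
                  hᵀ reg (hBasis v C) ≗ + ω ·ᵥ oedge S (inj₁ v) (inj₂ C) +ᵥ bond S (inj₂ C)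
      hᵀ-hBasis v C v∈C = begin-equality
        hᵀ reg (hBasis v C)
          ≈⟨ hᵀ.≗-cong (Γ-side.hBasis-star v C) ⟩
        hᵀ reg (Γ.Σᵥ (allFin n) (λ u → χ (mem C u) Γ.·ᵥ oedge Γ v u))
          ≈⟨ hᵀ.Σ-homo (allFin n) _ ⟩
        Σᵥ[ u ∈ allFin n ] hᵀ reg (χ (mem C u) Γ.·ᵥ oedge Γ v u)
          ≈⟨ Σᵥ-cong (allFin n) (λ u → hᵀ.·-homo (χ (mem C u)) (oedge Γ v u)) ⟩
        Σᵥ[ u ∈ allFin n ] (χ (mem C u) ·ᵥ hᵀ reg (oedge Γ v u))
          ≈⟨ Σᵥ-cong (allFin n) (λ u → χ·ᵥ-cong (mem C u) (hᵀ-oedge C v∈C)) ⟩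
        Σᵥ[ u ∈ allFin n ] (χ (mem C u) ·ᵥ (oedge S (inj₁ v) (inj₂ C) +ᵥ oedge S (inj₂ C) (inj₁ u)))
          ≈⟨ Σᵥ-cong (allFin n) (λ u p q → ℤP.*-distribˡ-+ (χ (mem C u)) _ _) ⟩
        Σᵥ[ u ∈ allFin n ] (χ (mem C u) ·ᵥ oedge S (inj₁ v) (inj₂ C)
                             +ᵥ χ (mem C u) ·ᵥ oedge S (inj₂ C) (inj₁ u))
          ≈⟨ Σᵥ-+ (allFin n) _ _ ⟩
        Σᵥ[ u ∈ allFin n ] (χ (mem C u) ·ᵥ oedge S (inj₁ v) (inj₂ C))
          +ᵥ Σᵥ[ u ∈ allFin n ] (χ (mem C u) ·ᵥ oedge S (inj₂ C) (inj₁ u))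
          ≈⟨ +ᵥ-cong (≗-trans (Σᵥ-scalar (allFin n) _ (oedge S (inj₁ v) (inj₂ C)))
                              (λ p q → cong (_* oedge S (inj₁ v) (inj₂ C) p q) (clique-count C)))
                     (≗-sym (bond-clique C)) ⟩
        + ω ·ᵥ oedge S (inj₁ v) (inj₂ C) +ᵥ bond S (inj₂ C) ∎
        where open ∼-Reasoning

      hᵀh-summand∼ : ∀ (b : EVec S) v C →
        hᵀ reg (if mem C v then b (inj₁ v) (inj₂ C) Γ.·ᵥ hBasis v C else Γ.0ᵥ)
          ∼ + ω ·ᵥ (if mem C v then b (inj₁ v) (inj₂ C) ·ᵥ oedge S (inj₁ v) (inj₂ C) else 0ᵥ)
      hᵀh-summand∼ b v C with mem C v in v∈C
      ... | true  = begin
        hᵀ reg (k Γ.·ᵥ hBasis v C)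
          ≈⟨ hᵀ.·-homo k (hBasis v C) ⟩
        k ·ᵥ hᵀ reg (hBasis v C)
          ≈⟨ ·ᵥ-cong k (hᵀ-hBasis v C v∈C) ⟩
        k ·ᵥ (+ ω ·ᵥ oedge S (inj₁ v) (inj₂ C) +ᵥ bond S (inj₂ C))
          ≲⟨ ·ᵥ-cong∼ k (+ᵥ-span∼ (span-bond (inj₂ C))) ⟩
        k ·ᵥ (+ ω ·ᵥ oedge S (inj₁ v) (inj₂ C))
          ≈⟨ (λ p q → commute k (+ ω) (oedge S (inj₁ v) (inj₂ C) p q)) ⟩
        + ω ·ᵥ (k ·ᵥ oedge S (inj₁ v) (inj₂ C)) ∎
        where
        open ∼-Reasoning
        k : ℤ
        k = b (inj₁ v) (inj₂ C)
        commute : ∀ k w o → k * (w * o) ≡ w * (k * o)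
        commute = solve-∀
      ... | false = ≗⇒∼ λ p q → trans (hᵀ.0-homo p q) (sym (ℤP.*-zeroʳ (+ ω)))

      hᵀh∼ω : ∀ b → IsChain S b → hᵀ reg (h b) ∼ + ω ·ᵥ b
      hᵀh∼ω b b-chain = begin
        hᵀ reg (h b)
          ≈⟨ hᵀ.Σ-homo (allFin n) _ ⟩
        Σᵥ[ v ∈ allFin n ] hᵀ reg (Γ.Σᵥ cliques (summand v))
          ≈⟨ Σᵥ-cong (allFin n) (λ v → hᵀ.Σ-homo cliques (summand v)) ⟩
        Σᵥ[ v ∈ allFin n ] Σᵥ[ C ∈ cliques ] hᵀ reg (summand v C)
          ≲⟨ Σᵥ-cong∼ (allFin n) (λ v → Σᵥ-cong∼ cliques (hᵀh-summand∼ b v)) ⟩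
        Σᵥ[ v ∈ allFin n ] Σᵥ[ C ∈ cliques ] (+ ω ·ᵥ component v C)
          ≈⟨ Σᵥ-cong (allFin n) (λ v → Σᵥ-· cliques (+ ω) (component v)) ⟩
        Σᵥ[ v ∈ allFin n ] (+ ω ·ᵥ Σᵥ cliques (component v))
          ≈⟨ Σᵥ-· (allFin n) (+ ω) _ ⟩
        + ω ·ᵥ Σᵥ[ v ∈ allFin n ] Σᵥ cliques (component v)
          ≈⟨ ·ᵥ-cong (+ ω) (S-chain-decomposition b b-chain) ⟨
        + ω ·ᵥ b ∎
        where
        open ∼-Reasoning
        summand : Fin n → Clique → EVec Γ
        summand v C = if mem C v then b (inj₁ v) (inj₂ C) Γ.·ᵥ hBasis v C else Γ.0ᵥ
        component : Fin n → Clique → EVec S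
        component v C = if mem C v then b (inj₁ v) (inj₂ C) ·ᵥ oedge S (inj₁ v) (inj₂ C) else 0ᵥ

lemma5p4 : (n : ℕ) (adj : Fin n → Fin n → Bool)
           (adj-sym : ∀ x y → adj x y ≡ adj y x)
           (adj-irr : ∀ x → adj x x ≡ false)
           (ω : ℕ) → 2 ≤ ω →
           let open Setup n adj adj-sym adj-irr ω in
           (reg : CliqueRegular) →
           ((a : EVec Γ) → IsChain Γ a →
              InBondPlusCycle Γ (_⊖_ Γ (h (hᵀ reg a)) (_·_ Γ (+ ω) a)))
           ×
           ((b : EVec S) → IsChain S b →
              InBondPlusCycle S (_⊖_ S (hᵀ reg (h b)) (_·_ S (+ ω) b)))
lemma5p4 n adj adj-sym adj-irr ω _ reg =
  (λ a a-chain → Γ.difference∈span (Γ-side.hhᵀ∼ω reg a a-chain)) ,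
  (λ b b-chain → S.difference∈span (S-side.hᵀh∼ω reg b b-chain))
  where open CliqueGraph n adj adj-sym adj-irr ω
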